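{- Let $a,b,c,d$ be distinct variables. Then the sequent $d \to d \cdot b \cdot \bigl((c \cdot b) \wedge (a \backslash a)\bigr) \cdot c$ semantically follows from the hypothesis $a \backslash a \to b \cdot c$ on the class of square R-models, but it does not syntactically follow from $a \backslash a \to b \cdot c$ in the calculus $\mathbf{L}^{\!\Lambda}\wedge\mathbf{0}\mathbf{1}$. Consequently, the calculus $\mathbf{L}^{\!\Lambda}\wedge$ (the fragment without the constants $\mathbf{0},\mathbf{1}$) is not strongly complete w.r.t. square R-models, and $\mathbf{L}^{\!\Lambda}\wedge\mathbf{0}\mathbf{1}$ is not strongly complete w.r.t. non-standard square R-models.
   Context: Formulae are built from variables and the constants $\mathbf{0}$, $\mathbf{1}$ using the binary connectives $\cdot$ (product), $\backslash$, $/$ (left and right division), $\wedge$ (intersection). Sequents are $\Pi \to B$ with $\Pi$ a possibly empty sequence of formulae. $\mathbf{L}^{\!\Lambda}\wedge\mathbf{0}\mathbf{1}$ is the Lambek calculus allowing empty antecedents, extended with intersection and constants, given by the Gentzen-style axioms and rules: $A \to A$; Cut; $\backslash L$: from $\Pi \to A$ and $\Gamma, B, \Delta \to C$ infer $\Gamma, \Pi, A\backslash B, \Delta \to C$; $\backslash R$: from $A,\Pi \to B$ infer $\Pi \to A \backslash B$ (symmetric rules for $/$); $\cdot L$: from $\Gamma, A, B, \Delta \to C$ infer $\Gamma, A\cdot B, \Delta \to C$; $\cdot R$: from $\Pi \to A$ and $\Delta \to B$ infer $\Pi,\Delta \to A \cdot B$; $\wedge L_{1,2}$: from $\Gamma,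 A, \Delta \to C$ (resp. $\Gamma,B,\Delta\to C$) infer $\Gamma, A\wedge B, \Delta \to C$; $\wedge R$: from $\Pi \to A$ and $\Pi \to B$ infer $\Pi \to A \wedge B$; $\mathbf{0}L$: $\Gamma,\mathbf{0},\Delta \to C$; $\mathbf{1}L$: from $\Gamma,\Delta\to C$ infer $\Gamma,\mathbf{1},\Delta \to C$; $\mathbf{1}R$: $\Lambda \to \mathbf{1}$ ($\Lambda$ = empty sequence). A sequent syntactically follows from a set of hypotheses $\mathcal{H}$ if it is derivable with the sequents of $\mathcal{H}$ added as extra axioms. A square R-model is $(W, v)$ with $W\neq\varnothing$ and $v$ mapping formulae to binary relations on $W$ such that $v(A\cdot B)=v(A)\circ v(B)$, $v(A\backslash B)=\{(y,z)\mid \forall x\,((x,y)\in v(A)\Rightarrow (x,z)\in v(B))\}$, $v(B/A)=\{(x,y)\mid \forall z\,((y,z)\in v(A)\Rightarrow (x,z)\in v(B))\}$, $v(A\wedge B)=v(A)\cap v(B)$. A sequent $A_1,\dots,A_n\to B$ is true if $v(A_1)\circ\dots\circ v(A_n)\subseteq v(B)$, and $\Lambda \to B$ is true if the diagonal $\delta=\{(x,x)\mid x\in W\}\subseteq v(B)$. A non-standard square R-model additionally has a family $\mathfrak{A}$ of relations on $W$ closed under $\circ,\backslash,/,\cap$ containing all values of $v$, with $v(\mathbf{1})$ being the $\mathfrak{A}$-unit (neutral for $\circ$ on $\mathfrak{A}$) and $v(\mathbf{0})$ the $\mathfrak{A}$-zero (included in every member of $\mathfrak{A}$). A sequent semantically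 follows from $\mathcal{H}$ on a class of models if it is true in every model of the class in which all sequents of $\mathcal{H}$ are true. Strong completeness means semantic consequence implies syntactic consequence. -}

module Defs where

open import Data.Nat using (ℕ)
open import Data.List using (List; []; _∷_; _++_; [_]; map)
open import Data.Bool using (Bool; true; false; _∧_)
open import Data.Product using (Σ; _×_; _,_)
open import Relation.Binary.PropositionalEquality using (_≡_)

-- Formulae: variables (indexed by ℕ), constants 𝟎 𝟏, product _·_,
-- left division A ⧵ B  (= A \ B), right division B / A, intersection _⊓_ (= ∧).
data Fm : Set where
  var : ℕ → Fm
  𝟎 𝟏 : Fm
  _·_ _⧵_ _/_ _⊓_ : Fm → Fm → Fm

data Seq : Set where
  _⇒_ : List Fm → Fm → Seq

Hyps : Set₁
Hyps = Seq → Set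

⟨_⟩ : Seq → Hyps
⟨ s ⟩ t = t ≡ s

cf : Fm → Bool
cf (var _) = true
cf 𝟎 = false
cf 𝟏 = false
cf (A · B) = cf A ∧ cf B
cf (A ⧵ B) = cf A ∧ cf B
cf (A / B) = cf A ∧ cf B
cf (A ⊓ B) = cf A ∧ cf B

cfs : List Fm → Bool
cfs [] = true
cfs (A ∷ Π) = cf A ∧ cfs Π

ConstFree : Seq → Set
ConstFree (Π ⇒ B) = (cfs Π ∧ cf B) ≡ true

-- Derivability from hypotheses ℋ.  The flag k says whether the rules
-- for the constants (𝟎L, 𝟏L, 𝟏R) are available:
--   k = true  : L^Λ∧01,   k = false : L^Λ∧.
data Der (ℋ : Hyps) (k : Bool) : Seq → Set where
  hyp : ∀ {s} → ℋ s → Der ℋ k s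
  ax  : ∀ {A} → Der ℋ k ([ A ] ⇒ A)
  cut : ∀ {Γ Π Δ A C} → Der ℋ k (Π ⇒ A) → Der ℋ k ((Γ ++ A ∷ Δ) ⇒ C)
        → Der ℋ k ((Γ ++ Π ++ Δ) ⇒ C)
  ⧵L  : ∀ {Γ Π Δ A B C} → Der ℋ k (Π ⇒ A) → Der ℋ k ((Γ ++ B ∷ Δ) ⇒ C)
        → Der ℋ k ((Γ ++ Π ++ (A ⧵ B) ∷ Δ) ⇒ C)
  ⧵R  : ∀ {Π A B} → Der ℋ k ((A ∷ Π) ⇒ B) → Der ℋ k (Π ⇒ (A ⧵ B))
  /L  : ∀ {Γ Π Δ A B C} → Der ℋ k (Π ⇒ A) → Der ℋ k ((Γ ++ B ∷ Δ) ⇒ C)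
        → Der ℋ k ((Γ ++ (B / A) ∷ Π ++ Δ) ⇒ C)
  /R  : ∀ {Π A B} → Der ℋ k ((Π ++ [ A ]) ⇒ B) → Der ℋ k (Π ⇒ (B / A))
  ·L  : ∀ {Γ Δ A B C} → Der ℋ k ((Γ ++ A ∷ B ∷ Δ) ⇒ C)
        → Der ℋ k ((Γ ++ (A · B) ∷ Δ) ⇒ C)
  ·R  : ∀ {Π Δ A B} → Der ℋ k (Π ⇒ A) → Der ℋ k (Δ ⇒ B)
        → Der ℋ k ((Π ++ Δ) ⇒ (A · B))
  ⊓L₁ : ∀ {Γ Δ A B C} → Der ℋ k ((Γ ++ A ∷ Δ) ⇒ C)
        → Der ℋ k ((Γ ++ (A ⊓ B) ∷ Δ) ⇒ C)
  ⊓L₂ : ∀ {Γ Δ A B C} → Der ℋ k ((Γ ++ B ∷ Δ) ⇒ C)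
        → Der ℋ k ((Γ ++ (A ⊓ B) ∷ Δ) ⇒ C)
  ⊓R  : ∀ {Π A B} → Der ℋ k (Π ⇒ A) → Der ℋ k (Π ⇒ B) → Der ℋ k (Π ⇒ (A ⊓ B))
  𝟎L  : ∀ {Γ Δ C} → k ≡ true → Der ℋ k ((Γ ++ 𝟎 ∷ Δ) ⇒ C)
  𝟏L  : ∀ {Γ Δ C} → k ≡ true → Der ℋ k ((Γ ++ Δ) ⇒ C)
        → Der ℋ k ((Γ ++ 𝟏 ∷ Δ) ⇒ C)
  𝟏R  : k ≡ true → Der ℋ k ([] ⇒ 𝟏)

_⊢L∧01_ : Hyps → Seq → Set
ℋ ⊢L∧01 s = Der ℋ true s

_⊢L∧_ : Hyps → Seq → Set
ℋ ⊢L∧ s = Der ℋ false s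

Rel : Set → Set₁
Rel W = W → W → Set

module _ {W : Set} where
  _∘ʳ_ : Rel W → Rel W → Rel W
  (R ∘ʳ S) x z = Σ W (λ y → R x y × S y z)

  _⧵ʳ_ : Rel W → Rel W → Rel W
  (R ⧵ʳ S) y z = ∀ x → R x y → S x z

  _/ʳ_ : Rel W → Rel W → Rel W
  (S /ʳ R) x y = ∀ z → R y z → S x z

  _∩ʳ_ : Rel W → Rel W → Rel W
  (R ∩ʳ S) x y = R x y × S x y

  δ : Rel W
  δ x y = x ≡ y

  _⊆ʳ_ : Rel W → Rel W → Set
  R ⊆ʳ S = ∀ x y → R x y → S x y

  _≐_ : Rel W → Rel W → Set
  R ≐ S = (R ⊆ʳ S) × (S ⊆ʳ R)

  compose : Rel W → List (Rel W) → Rel W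
  compose R [] = R
  compose R (S ∷ Rs) = R ∘ʳ compose S Rs

-- Square R-models (the interpretation of 𝟎, 𝟏 is unconstrained here;
-- square R-models are only used for constant-free formulae)

record SquareRModel : Set₁ where
  field
    W    : Set
    w₀   : W                       -- W ≠ ∅
    v    : Fm → Rel W
    v-·  : ∀ A B → v (A · B) ≐ (v A ∘ʳ v B)
    v-⧵  : ∀ A B → v (A ⧵ B) ≐ (v A ⧵ʳ v B)
    v-/  : ∀ A B → v (B / A) ≐ (v B /ʳ v A)
    v-⊓  : ∀ A B → v (A ⊓ B) ≐ (v A ∩ʳ v B)

True : (W : Set) → (Fm → Rel W) → Seq → Set
True W v ([] ⇒ B) = δ ⊆ʳ v B
True W v ((A ∷ Π) ⇒ B) = compose (v A) (map v Π) ⊆ʳ v B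

record NonStdSquareRModel : Set₁ where
  field
    M : SquareRModel
  open SquareRModel M public
  field
    𝔄     : Rel W → Set
    𝔄-∘   : ∀ R S → 𝔄 R → 𝔄 S → 𝔄 (R ∘ʳ S)
    𝔄-⧵   : ∀ R S → 𝔄 R → 𝔄 S → 𝔄 (R ⧵ʳ S)
    𝔄-/   : ∀ R S → 𝔄 R → 𝔄 S → 𝔄 (R /ʳ S)
    𝔄-∩   : ∀ R S → 𝔄 R → 𝔄 S → 𝔄 (R ∩ʳ S)
    v∈𝔄   : ∀ A → 𝔄 (v A)
    unitˡ : ∀ R → 𝔄 R → (v 𝟏 ∘ʳ R) ≐ R
    unitʳ : ∀ R → 𝔄 R → (R ∘ʳ v 𝟏) ≐ R
    zero⊆ : ∀ R → 𝔄 R → v 𝟎 ⊆ʳ R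

SemSq : Hyps → Seq → Set₁
SemSq ℋ s = (M : SquareRModel) → let open SquareRModel M in
  (∀ t → ℋ t → True W v t) → True W v s

SemNS : Hyps → Seq → Set₁
SemNS ℋ s = (N : NonStdSquareRModel) → let open NonStdSquareRModel N in
  (∀ t → ℋ t → True W v t) → True W v s

StronglyComplete-L∧-Sq : Set₁
StronglyComplete-L∧-Sq = (ℋ : Hyps) (s : Seq) → (∀ t → ℋ t → ConstFree t) → ConstFree s
  → SemSq ℋ s → ℋ ⊢L∧ s

StronglyComplete-L∧01-NS : Set₁
StronglyComplete-L∧01-NS = (ℋ : Hyps) (s : Seq) → SemNS ℋ s → ℋ ⊢L∧01 s

{-# OPTIONS --safe #-}
-- In a square R-model the diagonal lies in v(a\a), so the hypothesis gives every point y a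
-- point z with b(y,z) and c(z,y).  Then (z,z) lies in both c·b and a\a, and any d-edge
-- (x,y) extends along y → z → z → y to a witness for the goal.  This loop argument has no
-- syntactic counterpart: the calculus is sound for residuated monoids with meets and a
-- bottom, and in the algebra of subsets of three atoms {e, b, c} with unit e, where
-- b·c = {e, b, c} but c·b = {b}, the valuation a, d ↦ {e}, b ↦ {b}, c ↦ {c} satisfies the
-- hypothesis while c·b meets a\a = {e} in ∅, so the right-hand side of the goal is empty.
-- The goal is constant-free and every non-standard model is a square model, so both strong
-- completeness claims fail on it.
module Submission where

open import Defs
open import Data.Bool using (Bool; true; false; T; not; _∧_; _∨_; if_then_else_)
open import Data.Bool.Properties using (T-∧)
open import Data.List using (List; []; _∷_; [_]; _++_; foldr; filterᵇ)
open import Data.Nat using (ℕ; _≟_)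
open import Data.Product using (Σ; _×_; _,_; proj₁; proj₂)
open import Function using (id)
open import Function.Bundles using (_⇔_; mk⇔; Equivalence)
open import Relation.Nullary using (¬_; does)
open import Relation.Nullary.Decidable using (dec-true; dec-false)
open import Relation.Binary.PropositionalEquality using (_≡_; _≢_; refl; sym; trans; subst₂; ≢-sym)

open Equivalence

hypothesis : ℕ → ℕ → ℕ → Seq
hypothesis a b c = [ var a ⧵ var a ] ⇒ (var b · var c)

goal : ℕ → ℕ → ℕ → ℕ → Seq
goal a b c d = [ var d ] ⇒ (((var d · var b) · ((var c · var b) ⊓ (var a ⧵ var a))) · var c)

module SquareRModelProperties (M : SquareRModel) where
  open SquareRModel M

  ·-intro : ∀ {A B x y z} → v A x y → v B y z → v (A · B) x z
  ·-intro {A} {B} {x} {y} {z} Axy Byz = proj₂ (v-· A B) x z (y , Axy , Byz)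

  ·-elim : ∀ {A B x z} → v (A · B) x z → Σ W λ y → v A x y × v B y z
  ·-elim {A} {B} {x} {z} = proj₁ (v-· A B) x z

  ⊓-intro : ∀ {A B x y} → v A x y → v B x y → v (A ⊓ B) x y
  ⊓-intro {A} {B} {x} {y} Axy Bxy = proj₂ (v-⊓ A B) x y (Axy , Bxy)

  ⧵-self-reflexive : ∀ A x → v (A ⧵ A) x x
  ⧵-self-reflexive A x = proj₂ (v-⧵ A A) x x (λ _ Axx → Axx)

goal-follows : ∀ a b c d → SemSq ⟨ hypothesis a b c ⟩ (goal a b c d)
goal-follows a b c d M hypothesis-true x y dxy =
  let z , byz , czy = ·-elim (hypothesis-true _ refl y y (⧵-self-reflexive (var a) y))
      zz∈cb⊓a⧵a = ⊓-intro (·-intro czy byz) (⧵-self-reflexive (var a) z)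
  in ·-intro (·-intro (·-intro dxy byz) zz∈cb⊓a⧵a) czy
  where
  open SquareRModelProperties M

SemSq⇒SemNS : ∀ {ℋ s} → SemSq ℋ s → SemNS ℋ s
SemSq⇒SemNS follows N = follows (NonStdSquareRModel.M N)

record ResiduatedMeetMonoid : Set₁ where
  infix  4 _≤_
  infixl 7 _∙_
  infixl 6 _⊓ᵃ_
  field
    Carrier        : Set
    _≤_            : Carrier → Carrier → Set
    ≤-refl         : ∀ {x} → x ≤ x
    ≤-trans        : ∀ {x y z} → x ≤ y → y ≤ z → x ≤ z
    _∙_            : Carrier → Carrier → Carrier
    ε              : Carrier
    ∙-assoc        : ∀ x y z → (x ∙ y) ∙ z ≤ x ∙ (y ∙ z) × x ∙ (y ∙ z) ≤ (x ∙ y) ∙ z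
    ∙-identityˡ    : ∀ x → ε ∙ x ≤ x × x ≤ ε ∙ x
    ∙-identityʳ    : ∀ x → x ∙ ε ≤ x × x ≤ x ∙ ε
    _⧵ᵃ_ _/ᵃ_ _⊓ᵃ_ : Carrier → Carrier → Carrier
    ⧵-residual     : ∀ {x y z} → (x ∙ z ≤ y) ⇔ (z ≤ x ⧵ᵃ y)
    /-residual     : ∀ {x y z} → (z ∙ x ≤ y) ⇔ (z ≤ y /ᵃ x)
    ⊓-lowerˡ       : ∀ x y → x ⊓ᵃ y ≤ x
    ⊓-lowerʳ       : ∀ x y → x ⊓ᵃ y ≤ y
    ⊓-greatest     : ∀ {x y z} → z ≤ x → z ≤ y → z ≤ x ⊓ᵃ y
    ⊥ᵃ             : Carrier
    ⊥ᵃ-least       : ∀ x → ⊥ᵃ ≤ x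

module ResiduatedMeetMonoidProperties (𝔸 : ResiduatedMeetMonoid) where
  open ResiduatedMeetMonoid 𝔸

  ∙-monoˡ : ∀ {x x′} y → x ≤ x′ → x ∙ y ≤ x′ ∙ y
  ∙-monoˡ y x≤x′ = /-residual .from (≤-trans x≤x′ (/-residual .to ≤-refl))

  ∙-monoʳ : ∀ x {y y′} → y ≤ y′ → x ∙ y ≤ x ∙ y′
  ∙-monoʳ x y≤y′ = ⧵-residual .from (≤-trans y≤y′ (⧵-residual .to ≤-refl))

  ⧵-elim : ∀ x y → x ∙ (x ⧵ᵃ y) ≤ y
  ⧵-elim x y = ⧵-residual .from ≤-refl

  /-elim : ∀ x y → (y /ᵃ x) ∙ x ≤ y
  /-elim x y = /-residual .from ≤-refl

  ∙-zeroˡ : ∀ x → ⊥ᵃ ∙ x ≤ ⊥ᵃ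
  ∙-zeroˡ x = /-residual .from (⊥ᵃ-least _)

  ∙-zeroʳ : ∀ x → x ∙ ⊥ᵃ ≤ ⊥ᵃ
  ∙-zeroʳ x = ⧵-residual .from (⊥ᵃ-least _)

module Interpretation (𝔸 : ResiduatedMeetMonoid) (ρ : ℕ → ResiduatedMeetMonoid.Carrier 𝔸) where
  open ResiduatedMeetMonoid 𝔸
  open ResiduatedMeetMonoidProperties 𝔸

  ⟦_⟧ : Fm → Carrier
  ⟦ var n ⟧ = ρ n
  ⟦ 𝟎 ⟧     = ⊥ᵃ
  ⟦ 𝟏 ⟧     = ε
  ⟦ A · B ⟧ = ⟦ A ⟧ ∙ ⟦ B ⟧
  ⟦ A ⧵ B ⟧ = ⟦ A ⟧ ⧵ᵃ ⟦ B ⟧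
  ⟦ B / A ⟧ = ⟦ B ⟧ /ᵃ ⟦ A ⟧
  ⟦ A ⊓ B ⟧ = ⟦ A ⟧ ⊓ᵃ ⟦ B ⟧

  ⟦_⟧* : List Fm → Carrier
  ⟦ [] ⟧*    = ε
  ⟦ A ∷ Π ⟧* = ⟦ A ⟧ ∙ ⟦ Π ⟧*

  Valid : Seq → Set
  Valid (Π ⇒ C) = ⟦ Π ⟧* ≤ ⟦ C ⟧

  ⟦++⟧-split : ∀ Γ Δ → ⟦ Γ ++ Δ ⟧* ≤ ⟦ Γ ⟧* ∙ ⟦ Δ ⟧*
  ⟦++⟧-split []      Δ = proj₂ (∙-identityˡ _)
  ⟦++⟧-split (A ∷ Γ) Δ = ≤-trans (∙-monoʳ ⟦ A ⟧ (⟦++⟧-split Γ Δ)) (proj₂ (∙-assoc _ _ _))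

  ⟦++⟧-merge : ∀ Γ Δ → ⟦ Γ ⟧* ∙ ⟦ Δ ⟧* ≤ ⟦ Γ ++ Δ ⟧*
  ⟦++⟧-merge []      Δ = proj₁ (∙-identityˡ _)
  ⟦++⟧-merge (A ∷ Γ) Δ = ≤-trans (proj₁ (∙-assoc _ _ _)) (∙-monoʳ ⟦ A ⟧ (⟦++⟧-merge Γ Δ))

  ⟦++⟧-monoˡ : ∀ Π Δ {x} → ⟦ Π ⟧* ≤ x → ⟦ Π ++ Δ ⟧* ≤ x ∙ ⟦ Δ ⟧*
  ⟦++⟧-monoˡ Π Δ Π≤x = ≤-trans (⟦++⟧-split Π Δ) (∙-monoˡ _ Π≤x)

  ⟦++⟧-monoʳ : ∀ Γ {Π Π′} → ⟦ Π ⟧* ≤ ⟦ Π′ ⟧* → ⟦ Γ ++ Π ⟧* ≤ ⟦ Γ ++ Π′ ⟧*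
  ⟦++⟧-monoʳ []      Π≤Π′ = Π≤Π′
  ⟦++⟧-monoʳ (A ∷ Γ) Π≤Π′ = ∙-monoʳ ⟦ A ⟧ (⟦++⟧-monoʳ Γ Π≤Π′)

  inContext : ∀ Γ {Π Π′ x} → ⟦ Π ⟧* ≤ ⟦ Π′ ⟧* → ⟦ Γ ++ Π′ ⟧* ≤ x → ⟦ Γ ++ Π ⟧* ≤ x
  inContext Γ Π≤Π′ = ≤-trans (⟦++⟧-monoʳ Γ Π≤Π′)

  sound : ∀ {ℋ k s} → (∀ t → ℋ t → Valid t) → Der ℋ k s → Valid s
  sound ℋ-valid (hyp h)                   = ℋ-valid _ h
  sound ℋ-valid ax                        = proj₁ (∙-identityʳ _)
  sound ℋ-valid (cut {Γ} {Π} p q)         =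
    inContext Γ (⟦++⟧-monoˡ Π _ (sound ℋ-valid p)) (sound ℋ-valid q)
  sound ℋ-valid (⧵L {Γ} {Π} p q)          =
    inContext Γ
      (≤-trans (⟦++⟧-monoˡ Π _ (sound ℋ-valid p))
               (≤-trans (proj₂ (∙-assoc _ _ _)) (∙-monoˡ _ (⧵-elim _ _))))
      (sound ℋ-valid q)
  sound ℋ-valid (/L {Γ} {Π} p q)          =
    inContext Γ
      (≤-trans (∙-monoʳ _ (⟦++⟧-monoˡ Π _ (sound ℋ-valid p)))
               (≤-trans (proj₂ (∙-assoc _ _ _)) (∙-monoˡ _ (/-elim _ _))))
      (sound ℋ-valid q)
  sound ℋ-valid (⧵R p)                    = ⧵-residual .to (sound ℋ-valid p)
  sound ℋ-valid (/R {Π} {A} p)            =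
    /-residual .to
      (≤-trans (∙-monoʳ _ (proj₂ (∙-identityʳ _)))
               (≤-trans (⟦++⟧-merge Π [ A ]) (sound ℋ-valid p)))
  sound ℋ-valid (·L {Γ} p)                = inContext Γ (proj₁ (∙-assoc _ _ _)) (sound ℋ-valid p)
  sound ℋ-valid (·R {Π} p q)              =
    ≤-trans (⟦++⟧-monoˡ Π _ (sound ℋ-valid p)) (∙-monoʳ _ (sound ℋ-valid q))
  sound ℋ-valid (⊓L₁ {Γ} p)               = inContext Γ (∙-monoˡ _ (⊓-lowerˡ _ _)) (sound ℋ-valid p)
  sound ℋ-valid (⊓L₂ {Γ} p)               = inContext Γ (∙-monoˡ _ (⊓-lowerʳ _ _)) (sound ℋ-valid p)
  sound ℋ-valid (⊓R p q)                  = ⊓-greatest (sound ℋ-valid p) (sound ℋ-valid q)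
  sound ℋ-valid (𝟎L {Γ} {Δ} _)            =
    ≤-trans (⟦++⟧-split Γ (𝟎 ∷ Δ))
      (≤-trans (∙-monoʳ _ (∙-zeroˡ _)) (≤-trans (∙-zeroʳ _) (⊥ᵃ-least _)))
  sound ℋ-valid (𝟏L {Γ} _ p)              = inContext Γ (proj₁ (∙-identityˡ _)) (sound ℋ-valid p)
  sound ℋ-valid (𝟏R _)                    = ≤-refl

infixr 1 _⇒ᵇ_ _⇔ᵇ_

_⇒ᵇ_ : Bool → Bool → Bool
a ⇒ᵇ b = not a ∨ b

_⇔ᵇ_ : Bool → Bool → Bool
a ⇔ᵇ b = (a ⇒ᵇ b) ∧ (b ⇒ᵇ a)

⇒ᵇ-elim : ∀ {a b} → T (a ⇒ᵇ b) → T a → T b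
⇒ᵇ-elim {true} b-holds _ = b-holds

⇔ᵇ-elim : ∀ {a b} → T (a ⇔ᵇ b) → T a ⇔ T b
⇔ᵇ-elim {false} {false} _ = mk⇔ id id
⇔ᵇ-elim {true}  {true}  _ = mk⇔ id id

∀ᴮ : (Bool → Bool) → Bool
∀ᴮ p = p false ∧ p true

∀ᴮ-elim : (p : Bool → Bool) → T (∀ᴮ p) → ∀ b → T (p b)
∀ᴮ-elim p h false = proj₁ (T-∧ .to h)
∀ᴮ-elim p h true  = proj₂ (T-∧ .to h)

module SubsetAlgebra where

  infixl 9 _∙_ _⧵ˢ_ _/ˢ_
  infixl 8 _∩_ _∪_
  infix  7 _⊆ᵇ_
  infix  4 _≤_

  data Sub : Set where
    mk : (e b c : Bool) → Sub

  ∅ ε β γ : Sub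
  ∅ = mk false false false
  ε = mk true  false false
  β = mk false true  false
  γ = mk false false true

  _∪_ _∩_ : Sub → Sub → Sub
  mk e b c ∪ mk e′ b′ c′ = mk (e ∨ e′) (b ∨ b′) (c ∨ c′)
  mk e b c ∩ mk e′ b′ c′ = mk (e ∧ e′) (b ∧ b′) (c ∧ c′)

  _⊆ᵇ_ : Sub → Sub → Bool
  mk e b c ⊆ᵇ mk e′ b′ c′ = (e ⇒ᵇ e′) ∧ (b ⇒ᵇ b′) ∧ (c ⇒ᵇ c′)

  -- The product of atoms is  e·x = x·e = x,  b·b = c·b = {b},  b·c = {e, b, c},
  -- c·c = {e, c};  it is extended to subsets by taking unions.
  _∙_ : Sub → Sub → Sub
  mk xe xb xc ∙ mk ye yb yc =
    mk ((xe ∧ ye) ∨ (xb ∧ yc) ∨ (xc ∧ yc))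
       ((xe ∧ yb) ∨ (xb ∧ ye) ∨ (xb ∧ yb) ∨ (xb ∧ yc) ∨ (xc ∧ yb))
       ((xe ∧ yc) ∨ (xc ∧ ye) ∨ (xb ∧ yc) ∨ (xc ∧ yc))

  elements : List Sub
  elements = mk false false false ∷ mk false false true ∷ mk false true false ∷ mk false true true
           ∷ mk true  false false ∷ mk true  false true ∷ mk true  true false ∷ mk true  true true ∷ []

  ⋃ : List Sub → Sub
  ⋃ = foldr _∪_ ∅

  _⧵ˢ_ _/ˢ_ : Sub → Sub → Sub
  x ⧵ˢ y = ⋃ (filterᵇ (λ z → x ∙ z ⊆ᵇ y) elements)
  y /ˢ x = ⋃ (filterᵇ (λ z → z ∙ x ⊆ᵇ y) elements)

  _≤_ : Sub → Sub → Set
  x ≤ y = T (x ⊆ᵇ y)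

  ∀ˢ : (Sub → Bool) → Bool
  ∀ˢ p = ∀ᴮ λ e → ∀ᴮ λ b → ∀ᴮ λ c → p (mk e b c)

  ∀ˢ-elim : (p : Sub → Bool) → T (∀ˢ p) → ∀ x → T (p x)
  ∀ˢ-elim p h (mk e b c) =
    ∀ᴮ-elim (λ c → p (mk e b c))
      (∀ᴮ-elim (λ b → ∀ᴮ λ c → p (mk e b c))
        (∀ᴮ-elim (λ e → ∀ᴮ λ b → ∀ᴮ λ c → p (mk e b c)) h e) b) c

  ∀ˢ-elim₂ : (p : Sub → Sub → Bool) → T (∀ˢ λ x → ∀ˢ (p x)) → ∀ x y → T (p x y)
  ∀ˢ-elim₂ p h x = ∀ˢ-elim (p x) (∀ˢ-elim (λ x → ∀ˢ (p x)) h x)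

  ∀ˢ-elim₃ : (p : Sub → Sub → Sub → Bool) → T (∀ˢ λ x → ∀ˢ λ y → ∀ˢ (p x y)) → ∀ x y z → T (p x y z)
  ∀ˢ-elim₃ p h x y = ∀ˢ-elim (p x y) (∀ˢ-elim₂ (λ x y → ∀ˢ (p x y)) h x y)

  algebra : ResiduatedMeetMonoid
  algebra = record
    { Carrier     = Sub
    ; _≤_         = _≤_
    ; ≤-refl      = λ {x} → ∀ˢ-elim (λ x → x ⊆ᵇ x) _ x
    ; ≤-trans     = λ {x} {y} {z} x≤y y≤z →
        ⇒ᵇ-elim (∀ˢ-elim₃ (λ x y z → x ⊆ᵇ y ∧ y ⊆ᵇ z ⇒ᵇ x ⊆ᵇ z) _ x y z) (T-∧ .from (x≤y , y≤z))
    ; _∙_         = _∙_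
    ; ε           = ε
    ; ∙-assoc     = λ x y z →
        T-∧ .to (∀ˢ-elim₃ (λ x y z → (x ∙ y) ∙ z ⊆ᵇ x ∙ (y ∙ z) ∧ x ∙ (y ∙ z) ⊆ᵇ (x ∙ y) ∙ z) _ x y z)
    ; ∙-identityˡ = λ x → T-∧ .to (∀ˢ-elim (λ x → ε ∙ x ⊆ᵇ x ∧ x ⊆ᵇ ε ∙ x) _ x)
    ; ∙-identityʳ = λ x → T-∧ .to (∀ˢ-elim (λ x → x ∙ ε ⊆ᵇ x ∧ x ⊆ᵇ x ∙ ε) _ x)
    ; _⧵ᵃ_        = _⧵ˢ_
    ; _/ᵃ_        = _/ˢ_
    ; _⊓ᵃ_        = _∩_
    ; ⧵-residual  = λ {x} {y} {z} →
        ⇔ᵇ-elim (∀ˢ-elim₃ (λ x y z → x ∙ z ⊆ᵇ y ⇔ᵇ z ⊆ᵇ x ⧵ˢ y) _ x y z)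
    ; /-residual  = λ {x} {y} {z} →
        ⇔ᵇ-elim (∀ˢ-elim₃ (λ x y z → z ∙ x ⊆ᵇ y ⇔ᵇ z ⊆ᵇ y /ˢ x) _ x y z)
    ; ⊓-lowerˡ    = ∀ˢ-elim₂ (λ x y → x ∩ y ⊆ᵇ x) _
    ; ⊓-lowerʳ    = ∀ˢ-elim₂ (λ x y → x ∩ y ⊆ᵇ y) _
    ; ⊓-greatest  = λ {x} {y} {z} z≤x z≤y →
        ⇒ᵇ-elim (∀ˢ-elim₃ (λ x y z → z ⊆ᵇ x ∧ z ⊆ᵇ y ⇒ᵇ z ⊆ᵇ x ∩ y) _ x y z) (T-∧ .from (z≤x , z≤y))
    ; ⊥ᵃ          = ∅
    ; ⊥ᵃ-least    = ∀ˢ-elim (λ x → ∅ ⊆ᵇ x) _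
    }

  β∙γ-greatest : ∀ x → x ≤ β ∙ γ
  β∙γ-greatest = ∀ˢ-elim (λ x → x ⊆ᵇ β ∙ γ) _

  goal-fails : ∀ {xa xb xc xd} → xa ≡ ε → xb ≡ β → xc ≡ γ → xd ≡ ε →
    ¬ (xd ∙ ε ≤ xd ∙ xb ∙ (xc ∙ xb ∩ xa ⧵ˢ xa) ∙ xc)
  goal-fails refl refl refl refl ()

infixl 5 _[_≔_]

_[_≔_] : {A : Set} → (ℕ → A) → ℕ → A → ℕ → A
(f [ n ≔ x ]) m = if does (m ≟ n) then x else f m

[≔]-same : ∀ {A : Set} (f : ℕ → A) n x → (f [ n ≔ x ]) n ≡ x
[≔]-same f n x rewrite dec-true (n ≟ n) refl = refl

[≔]-other : ∀ {A : Set} (f : ℕ → A) {m n} x → m ≢ n → (f [ n ≔ x ]) m ≡ f m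
[≔]-other f {m} {n} x m≢n rewrite dec-false (m ≟ n) m≢n = refl

goal-underivable : ∀ {a b c d} → a ≢ b → a ≢ c → b ≢ c → b ≢ d → c ≢ d →
  ∀ {k} → ¬ Der ⟨ hypothesis a b c ⟩ k (goal a b c d)
goal-underivable {a} {b} {c} {d} a≢b a≢c b≢c b≢d c≢d derivation =
  goal-fails ρ-a ρ-b ρ-c ρ-d (sound hypothesis-valid derivation)
  where
  open SubsetAlgebra
  ρ₀ ρ : ℕ → Sub
  ρ₀ = (λ _ → ε) [ b ≔ β ]
  ρ  = ρ₀ [ c ≔ γ ]
  open Interpretation algebra ρ
  ρ-a : ρ a ≡ ε
  ρ-a = trans ([≔]-other ρ₀ γ a≢c) ([≔]-other (λ _ → ε) β a≢b)
  ρ-b : ρ b ≡ β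
  ρ-b = trans ([≔]-other ρ₀ γ b≢c) ([≔]-same (λ _ → ε) b β)
  ρ-c : ρ c ≡ γ
  ρ-c = [≔]-same ρ₀ c γ
  ρ-d : ρ d ≡ ε
  ρ-d = trans ([≔]-other ρ₀ γ (≢-sym c≢d)) ([≔]-other (λ _ → ε) β (≢-sym b≢d))
  hypothesis-valid : ∀ t → ⟨ hypothesis a b c ⟩ t → Valid t
  hypothesis-valid _ refl =
    subst₂ (λ y z → (ρ a ⧵ˢ ρ a) ∙ ε ≤ y ∙ z) (sym ρ-b) (sym ρ-c) (β∙γ-greatest ((ρ a ⧵ˢ ρ a) ∙ ε))

theorem4p1 : ((a b c d : ℕ) → a ≢ b → a ≢ c → a ≢ d → b ≢ c → b ≢ d → c ≢ d →
      SemSq ⟨ [ var a ⧵ var a ] ⇒ (var b · var c) ⟩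
            ([ var d ] ⇒ (((var d · var b) · ((var c · var b) ⊓ (var a ⧵ var a))) · var c))
      × ¬ (⟨ [ var a ⧵ var a ] ⇒ (var b · var c) ⟩
            ⊢L∧01 ([ var d ] ⇒ (((var d · var b) · ((var c · var b) ⊓ (var a ⧵ var a))) · var c))))
    × ¬ StronglyComplete-L∧-Sq
    × ¬ StronglyComplete-L∧01-NS
theorem4p1 =
    (λ a b c d a≢b a≢c _ b≢c b≢d c≢d →
      goal-follows a b c d , goal-underivable a≢b a≢c b≢c b≢d c≢d)
  , (λ complete → underivable (complete _ _ (λ { _ refl → refl }) refl (goal-follows 0 1 2 3)))
  , (λ complete → underivable (complete _ _ (SemSq⇒SemNS {s = goal 0 1 2 3} (goal-follows 0 1 2 3))))
  where
  underivable : ∀ {k} → ¬ Der ⟨ hypothesis 0 1 2 ⟩ k (goal 0 1 2 3)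
  underivable = goal-underivable (λ ()) (λ ()) (λ ()) (λ ()) (λ ())
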